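{- Let $G$ be a graph of order $n\geq 2$ and let $t\geq 2$. Then $\lambda(M^t(G))=2^t(n+1)-2$ if and only if $G\cong K_n$ or $\mathrm{diam}(G)=2$.
   Context: Graphs are finite, simple, undirected. $\mathrm{diam}(G)$ is the largest distance between two vertices of $G$ (infinite if $G$ is disconnected). An $L(2,1)$-labeling of $G$ is a map $f:V\to\{0,1,2,\dots\}$ with $|f(x)-f(y)|\ge 2$ if $d_G(x,y)=1$ and $|f(x)-f(y)|\ge1$ if $d_G(x,y)=2$; $\lambda(G)$ is the minimum over such $f$ of the largest label. For $V=\{v_1,\dots,v_n\}$, $M(G)$ has vertex set $V\cup\{v_1',\dots,v_n'\}\cup\{u\}$ and edge set $E\cup\{v_iv_j' : v_iv_j\in E\}\cup\{v_i'u: 1\le i\le n\}$; $M^0(G)=G$, $M^t(G)=M(M^{t-1}(G))$. -}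

module Defs where

open import Data.Nat using (ℕ; zero; suc; _+_; _≤_; _<_; ∣_-_∣)
open import Data.Fin using (Fin; zero; suc; splitAt)
open import Data.Bool using (Bool; true; false)
open import Data.Sum using (_⊎_; inj₁; inj₂)
open import Data.Product using (Σ; _×_; ∃; ∃-syntax; _,_)
open import Relation.Binary.PropositionalEquality using (_≡_)
open import Relation.Nullary using (¬_; Dec; yes; no)
open import Function.Bundles using (_↔_; Inverse)
open import Data.Fin using (_≟_)

record Graph (n : ℕ) : Set where
  field
    adj    : Fin n → Fin n → Bool
    sym    : ∀ x y → adj x y ≡ adj y x
    irrefl : ∀ x → adj x x ≡ false
open Graph public

Edge : ∀ {n} → Graph n → Fin n → Fin n → Set
Edge G x y = adj G x y ≡ true

HasWalk : ∀ {n} → Graph n → ℕ → Fin n → Fin n → Set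
HasWalk G zero    x y = x ≡ y
HasWalk G (suc k) x y = ∃[ z ] (Edge G x z × HasWalk G k z y)

Dist : ∀ {n} → Graph n → Fin n → Fin n → ℕ → Set
Dist G x y d = HasWalk G d x y × (∀ k → k < d → ¬ HasWalk G k x y)

Diam : ∀ {n} → Graph n → ℕ → Set
Diam {n} G d = (∀ x y → ∃[ e ] (e ≤ d × Dist G x y e)) × (∃[ x ] ∃[ y ] Dist G x y d)

IsL21 : ∀ {n} → Graph n → (Fin n → ℕ) → Set
IsL21 G f = ∀ x y → (Dist G x y 1 → 2 ≤ ∣ f x - f y ∣) × (Dist G x y 2 → 1 ≤ ∣ f x - f y ∣)

IsLambda : ∀ {n} → Graph n → ℕ → Set
IsLambda G k =
  (∃[ f ] (IsL21 G f × (∀ x → f x ≤ k))) ×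
  (∀ f → IsL21 G f → ∃[ x ] (k ≤ f x))

bnot : Bool → Bool
bnot true = false
bnot false = true

eqb : ∀ {n} → Fin n → Fin n → Bool
eqb x y with x ≟ y
... | yes _ = true
... | no _ = false

eqb-sym : ∀ {n} (x y : Fin n) → eqb x y ≡ eqb y x
eqb-sym x y with x ≟ y | y ≟ x
... | yes _ | yes _ = Relation.Binary.PropositionalEquality.refl
... | no _  | no _  = Relation.Binary.PropositionalEquality.refl
... | yes p | no q  = Data.Empty.⊥-elim (q (Relation.Binary.PropositionalEquality.sym p))
  where import Data.Empty
... | no q  | yes p = Data.Empty.⊥-elim (q (Relation.Binary.PropositionalEquality.sym p))
  where import Data.Empty

eqb-refl : ∀ {n} (x : Fin n) → eqb x x ≡ true
eqb-refl x with x ≟ x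
... | yes _ = Relation.Binary.PropositionalEquality.refl
... | no q = Data.Empty.⊥-elim (q Relation.Binary.PropositionalEquality.refl)
  where import Data.Empty

complete : (n : ℕ) → Graph n
complete n = record
  { adj = λ x y → bnot (eqb x y)
  ; sym = λ x y → Relation.Binary.PropositionalEquality.cong bnot (eqb-sym x y)
  ; irrefl = λ x → Relation.Binary.PropositionalEquality.cong bnot (eqb-refl x) }

_≅_ : ∀ {n m} → Graph n → Graph m → Set
_≅_ {n} {m} G H = Σ (Fin n ↔ Fin m) λ σ →
  ∀ x y → adj G x y ≡ adj H (Inverse.to σ x) (Inverse.to σ y)

-- Mycielskian. Vertex set Fin (suc (n + n)):
--   zero = u ; suc k with splitAt n k = inj₁ i : v_i ; inj₂ i : v_i'
data MV (n : ℕ) : Set where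
  old  : Fin n → MV n
  copy : Fin n → MV n
  hub  : MV n

classify : ∀ {n} → Fin (suc (n + n)) → MV n
classify zero = hub
classify {n} (suc k) with splitAt n k
... | inj₁ i = old i
... | inj₂ i = copy i

madj : ∀ {n} → Graph n → MV n → MV n → Bool
madj G (old i)  (old j)  = adj G i j
madj G (old i)  (copy j) = adj G i j
madj G (copy i) (old j)  = adj G j i
madj G (copy i) (copy j) = false
madj G (copy i) hub      = true
madj G hub      (copy j) = true
madj G (old i)  hub      = false
madj G hub      (old j)  = false
madj G hub      hub      = false

madj-sym : ∀ {n} (G : Graph n) a b → madj G a b ≡ madj G b a
madj-sym G (old i)  (old j)  = sym G i j
madj-sym G (old i)  (copy j) = Relation.Binary.PropositionalEquality.refl
madj-sym G (copy i) (old j)  = Relation.Binary.PropositionalEquality.refl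
madj-sym G (copy i) (copy j) = Relation.Binary.PropositionalEquality.refl
madj-sym G (copy i) hub      = Relation.Binary.PropositionalEquality.refl
madj-sym G hub      (copy j) = Relation.Binary.PropositionalEquality.refl
madj-sym G (old i)  hub      = Relation.Binary.PropositionalEquality.refl
madj-sym G hub      (old j)  = Relation.Binary.PropositionalEquality.refl
madj-sym G hub      hub      = Relation.Binary.PropositionalEquality.refl

madj-irrefl : ∀ {n} (G : Graph n) a → madj G a a ≡ false
madj-irrefl G (old i) = irrefl G i
madj-irrefl G (copy i) = Relation.Binary.PropositionalEquality.refl
madj-irrefl G hub = Relation.Binary.PropositionalEquality.refl

M : ∀ {n} → Graph n → Graph (suc (n + n))
M G = record
  { adj = λ x y → madj G (classify x) (classify y)
  ; sym = λ x y → madj-sym G (classify x) (classify y)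
  ; irrefl = λ x → madj-irrefl G (classify x) }

morder : ℕ → ℕ → ℕ
morder zero    n = n
morder (suc t) n = suc (morder t n + morder t n)

Mt : ∀ {n} (t : ℕ) → Graph n → Graph (morder t n)
Mt zero    G = G
Mt (suc t) G = M (Mt t G)

-- M^t(G) has 2^t(n+1) - 1 vertices, so the claimed value is its order minus one. If G is
-- complete or has diameter 2, then (as n ≥ 2) G has no isolated vertex, and every Mycielskian
-- iterate again has diameter at most 2; so any L(2,1)-labelling is injective and uses a label at
-- least the order minus one. Conversely, M(M(K)) always has an injective labelling by 0, …,
-- |V| - 1 in which adjacent vertices get labels at least 2 apart. If G is neither complete nor of
-- diameter 2, it has vertices x, y at distance at least 3, and so does K = M^{t-2}(G). In
-- M(M(K)) the vertex y can then take over the label of x, and the label it frees is squeezed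
-- out, which lowers the span by one.
module Submission where

open import Defs hiding (sym)
open import Data.Nat using (ℕ; zero; suc; pred; _+_; _*_; _^_; _∸_; _≤_; _<_; _<?_; _≤?_; z≤n; s≤s; s≤s⁻¹; ∣_-_∣)
open import Data.Nat.Properties
  using (≤-refl; ≤-trans; <-trans; <-≤-trans; <-cmp; <-asym; ≤∧≢⇒<; m≤n⇒m<n∨m≡n; <⇒≢; >⇒≢; <⇒≱; ≰⇒>;
         1+n≰n; n≤1+n; m≤m+n; m≤n+m; <⇒≤pred; pred-mono-≤; suc-injective; n≢0⇒n>0;
         m≡n⇒∣m-n∣≡0; ∣m-n∣≡0⇒m≡n; ∣-∣-comm; +-comm; +-identityʳ; *-comm; *-assoc; +-cancelˡ-≡;
         +-mono-≤; +-monoˡ-≤; +-monoʳ-≤; +-monoʳ-<; *-monoˡ-≤; module ≤-Reasoning)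
open import Data.Nat.Tactic.RingSolver using (solve-∀)
open import Data.Fin using (Fin; zero; suc; toℕ; fromℕ<; combine; splitAt; _↑ˡ_; _↑ʳ_; _≟_)
open import Data.Fin.Properties
  using (toℕ-injective; toℕ<n; toℕ-combine; combine-injective; splitAt-↑ˡ; splitAt-↑ʳ; join-splitAt;
         pigeonhole; fromℕ<-injective; any?)
  renaming (<⇒≢ to <ᶠ⇒≢)
open import Data.Bool using (true; false)
import Data.Bool.Properties as Bool
open import Data.Sum using (_⊎_; inj₁; inj₂; [_,_]′)
open import Data.Product using (_×_; ∃-syntax; _,_; proj₁; proj₂)
open import Data.Empty using (⊥)
open import Function using (_∘_)
open import Function.Bundles using (_⇔_; mk⇔; Inverse)
open import Function.Construct.Identity using (↔-id)
open import Function.Definitions using (Injective)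
open import Relation.Nullary using (¬_; Dec; yes; no; contradiction)
open import Relation.Nullary.Decidable using (¬?; _×-dec_; map′; decidable-stable)
open import Relation.Binary.PropositionalEquality
  using (_≡_; _≢_; refl; sym; trans; cong; subst; subst₂; ≢-sym; module ≡-Reasoning)
open import Relation.Binary.Definitions using (tri<; tri≈; tri>)

Separated : ℕ → ℕ → Set
Separated a b = 2 + a ≤ b ⊎ 2 + b ≤ a

Separated-sym : ∀ {a b} → Separated a b → Separated b a
Separated-sym (inj₁ 2+a≤b) = inj₂ 2+a≤b
Separated-sym (inj₂ 2+b≤a) = inj₁ 2+b≤a

2+m≤n⇒2≤∣m-n∣ : ∀ {m n} → 2 + m ≤ n → 2 ≤ ∣ m - n ∣
2+m≤n⇒2≤∣m-n∣ {zero}          2≤n          = 2≤n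
2+m≤n⇒2≤∣m-n∣ {suc m} {suc n} (s≤s 2+m≤n) = 2+m≤n⇒2≤∣m-n∣ 2+m≤n

Separated⇒2≤∣-∣ : ∀ {a b} → Separated a b → 2 ≤ ∣ a - b ∣
Separated⇒2≤∣-∣         (inj₁ 2+a≤b) = 2+m≤n⇒2≤∣m-n∣ 2+a≤b
Separated⇒2≤∣-∣ {a} {b} (inj₂ 2+b≤a) = subst (2 ≤_) (∣-∣-comm b a) (2+m≤n⇒2≤∣m-n∣ 2+b≤a)

Separated⇒suc≢ : ∀ {a b} → Separated a b → suc a ≢ b
Separated⇒suc≢     (inj₁ 2+a≤b) refl = 1+n≰n 2+a≤b
Separated⇒suc≢ {a} (inj₂ 3+a≤a) refl = <⇒≱ (m≤n+m (suc a) 2) 3+a≤a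

≢∧≢±1⇒Separated : ∀ {a b} → a ≢ b → suc a ≢ b → a ≢ suc b → Separated a b
≢∧≢±1⇒Separated {a} {b} a≢b 1+a≢b a≢1+b with <-cmp a b
... | tri< a<b _ _ = inj₁ (≤∧≢⇒< a<b 1+a≢b)
... | tri≈ _ a≡b _ = contradiction a≡b a≢b
... | tri> _ _ b<a = inj₂ (≤∧≢⇒< b<a (≢-sym a≢1+b))

m≢n⇒1≤∣m-n∣ : ∀ {m n} → m ≢ n → 1 ≤ ∣ m - n ∣
m≢n⇒1≤∣m-n∣ m≢n = n≢0⇒n>0 (m≢n ∘ ∣m-n∣≡0⇒m≡n)

1≤∣m-n∣⇒m≢n : ∀ {m n} → 1 ≤ ∣ m - n ∣ → m ≢ n
1≤∣m-n∣⇒m≢n 1≤∣m-n∣ m≡n = 1+n≰n (subst (1 ≤_) (m≡n⇒∣m-n∣≡0 m≡n) 1≤∣m-n∣)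

shrink : ℕ → ℕ → ℕ
shrink c ℓ with ℓ <? c
... | yes _ = ℓ
... | no  _ = pred ℓ

shrink-below : ∀ {c ℓ} → ℓ < c → shrink c ℓ ≡ ℓ
shrink-below {c} {ℓ} ℓ<c with ℓ <? c
... | yes _   = refl
... | no ℓ≮c = contradiction ℓ<c ℓ≮c

shrink-above : ∀ {c ℓ} → c < ℓ → shrink c ℓ ≡ pred ℓ
shrink-above {c} {ℓ} c<ℓ with ℓ <? c
... | yes ℓ<c = contradiction ℓ<c (<-asym c<ℓ)
... | no _    = refl

shrink-mono-< : ∀ {c a b} → a ≢ c → b ≢ c → a < b → shrink c a < shrink c b
shrink-mono-< {c} {a} {b} a≢c b≢c a<b with <-cmp a c | <-cmp b c
... | tri≈ _ a≡c _ | _              = contradiction a≡c a≢c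
... | _            | tri≈ _ b≡c _   = contradiction b≡c b≢c
... | tri< a<c _ _ | tri< b<c _ _   rewrite shrink-below a<c | shrink-below b<c = a<b
... | tri< a<c _ _ | tri> _ _ c<b   rewrite shrink-below a<c | shrink-above c<b = <-≤-trans a<c (<⇒≤pred c<b)
... | tri> _ _ c<a | tri< b<c _ _   = contradiction b<c (<-asym (<-trans c<a a<b))
... | tri> _ _ c<a@(s≤s _) | tri> _ _ c<b
    rewrite shrink-above c<a | shrink-above c<b = <⇒≤pred a<b

shrink-injective : ∀ {c a b} → a ≢ c → b ≢ c → shrink c a ≡ shrink c b → a ≡ b
shrink-injective {c} {a} {b} a≢c b≢c eq with <-cmp a b
... | tri< a<b _ _ = contradiction eq (<⇒≢ (shrink-mono-< a≢c b≢c a<b))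
... | tri≈ _ a≡b _ = a≡b
... | tri> _ _ b<a = contradiction eq (>⇒≢ (shrink-mono-< b≢c a≢c b<a))

-- The only gap of 2 that shrink c closes is the one from c - 1 to c + 1.
Straddles : ℕ → ℕ → ℕ → Set
Straddles c a b = suc a ≡ c × b ≡ suc c

straddle-gap : ∀ {c a b} → a < c → c < b → ¬ Straddles c a b → 3 + a ≤ b
straddle-gap {c} {a} {b} a<c c<b ¬straddle with m≤n⇒m<n∨m≡n a<c
... | inj₁ 1+a<c = ≤-trans (s≤s 1+a<c) c<b
... | inj₂ 1+a≡c =
  subst (λ z → suc (suc z) ≤ b) (sym 1+a≡c) (≤∧≢⇒< c<b (λ 1+c≡b → ¬straddle (1+a≡c , sym 1+c≡b)))

shrink-gap : ∀ {c a b} → a ≢ c → b ≢ c → 2 + a ≤ b → ¬ Straddles c a b → 2 + shrink c a ≤ shrink c b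
shrink-gap {c} {a} {b} a≢c b≢c 2+a≤b ¬straddle with <-cmp a c | <-cmp b c
... | tri≈ _ a≡c _ | _              = contradiction a≡c a≢c
... | _            | tri≈ _ b≡c _   = contradiction b≡c b≢c
... | tri< a<c _ _ | tri< b<c _ _   rewrite shrink-below a<c | shrink-below b<c = 2+a≤b
... | tri< a<c _ _ | tri> _ _ c<b   rewrite shrink-below a<c | shrink-above c<b =
  pred-mono-≤ (straddle-gap a<c c<b ¬straddle)
... | tri> _ _ c<a | tri< b<c _ _   = contradiction b<c (<-asym (<-trans c<a (≤-trans (n≤1+n _) 2+a≤b)))
... | tri> _ _ c<a@(s≤s _) | tri> _ _ c<b
    rewrite shrink-above c<a | shrink-above c<b = pred-mono-≤ 2+a≤b

shrink-separated : ∀ {c a b} → a ≢ c → b ≢ c → Separated a b →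
                   ¬ Straddles c a b → ¬ Straddles c b a → Separated (shrink c a) (shrink c b)
shrink-separated a≢c b≢c (inj₁ 2+a≤b) ¬sab _    = inj₁ (shrink-gap a≢c b≢c 2+a≤b ¬sab)
shrink-separated a≢c b≢c (inj₂ 2+b≤a) _    ¬sba = inj₂ (shrink-gap b≢c a≢c 2+b≤a ¬sba)

shrink-< : ∀ {c ℓ B} → ℓ ≢ c → ℓ ≤ B → c ≤ B → shrink c ℓ < B
shrink-< {c} {ℓ} ℓ≢c ℓ≤B c≤B with <-cmp ℓ c
... | tri< ℓ<c _ _           rewrite shrink-below ℓ<c = <-≤-trans ℓ<c c≤B
... | tri≈ _ ℓ≡c _           = contradiction ℓ≡c ℓ≢c
... | tri> _ _ c<ℓ@(s≤s _)   rewrite shrink-above c<ℓ = ℓ≤B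

module _ {N : ℕ} (G : Graph N) where

  Edge-sym : ∀ {v w} → Edge G v w → Edge G w v
  Edge-sym {v} {w} v~w = trans (Graph.sym G w v) v~w

  Edge⇒≢ : ∀ {v w} → Edge G v w → v ≢ w
  Edge⇒≢ {v} v~v refl with trans (sym (irrefl G v)) v~v
  ... | ()

  Edge? : ∀ v w → Dec (Edge G v w)
  Edge? v w = adj G v w Bool.≟ true

  CommonNeighbour : Fin N → Fin N → Set
  CommonNeighbour v w = ∃[ z ] (Edge G v z × Edge G z w)

  CommonNeighbour-sym : ∀ {v w} → CommonNeighbour v w → CommonNeighbour w v
  CommonNeighbour-sym (z , v~z , z~w) = z , Edge-sym z~w , Edge-sym v~z

  CommonNeighbour? : ∀ v w → Dec (CommonNeighbour v w)
  CommonNeighbour? v w = any? λ z → Edge? v z ×-dec Edge? z w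

  record Far (x y : Fin N) : Set where
    constructor mkFar
    field
      distinct            : x ≢ y
      nonadjacent         : ¬ Edge G x y
      no-common-neighbour : ¬ CommonNeighbour x y

  Far? : ∀ x y → Dec (Far x y)
  Far? x y = map′ (λ (x≢y , x≁y , ¬cn) → mkFar x≢y x≁y ¬cn)
                  (λ (mkFar x≢y x≁y ¬cn) → x≢y , x≁y , ¬cn)
                  (¬? (x ≟ y) ×-dec ¬? (Edge? x y) ×-dec ¬? (CommonNeighbour? x y))

  Edge⇒Dist1 : ∀ {v w} → Edge G v w → Dist G v w 1
  Edge⇒Dist1 {w = w} v~w = (w , v~w , refl) , λ { zero _ v≡w → Edge⇒≢ v~w v≡w ; (suc _) (s≤s ()) }

  Dist1⇒Edge : ∀ {v w} → Dist G v w 1 → Edge G v w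
  Dist1⇒Edge ((_ , v~w , refl) , _) = v~w

  CommonNeighbour⇒Dist2 : ∀ {v w} → v ≢ w → ¬ Edge G v w → CommonNeighbour v w → Dist G v w 2
  CommonNeighbour⇒Dist2 {w = w} v≢w v≁w (z , v~z , z~w) =
    (z , v~z , w , z~w , refl) ,
    λ { zero _ v≡w → v≢w v≡w ; (suc zero) _ (_ , v~w , refl) → v≁w v~w ; (suc (suc _)) (s≤s (s≤s ())) }

  Dist2⇒CommonNeighbour : ∀ {v w} → Dist G v w 2 → v ≢ w × CommonNeighbour v w
  Dist2⇒CommonNeighbour ((z , v~z , _ , z~w , refl) , shorter) = shorter 0 (s≤s z≤n) , z , v~z , z~w

  EdgeSeparated : (Fin N → ℕ) → Set
  EdgeSeparated f = ∀ v w → Edge G v w → Separated (f v) (f w)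

  IsL21-intro : ∀ {f} → EdgeSeparated f → (∀ v w → v ≢ w → CommonNeighbour v w → f v ≢ f w) →
                IsL21 G f
  IsL21-intro separated distinct v w =
    (λ d → Separated⇒2≤∣-∣ (separated v w (Dist1⇒Edge d))) ,
    (λ d → let v≢w , cn = Dist2⇒CommonNeighbour d in m≢n⇒1≤∣m-n∣ (distinct v w v≢w cn))

  injective⇒IsL21 : ∀ {f} → EdgeSeparated f → Injective _≡_ _≡_ f → IsL21 G f
  injective⇒IsL21 separated injective = IsL21-intro separated (λ _ _ v≢w _ → v≢w ∘ injective)

  -- Diameter at most two, together with a vertex and no isolated vertices: this is the form
  -- in which the property passes to the Mycielskian.
  record Diam≤2 : Set where
    field
      near      : ∀ {x y} → x ≢ y → Edge G x y ⊎ CommonNeighbour x y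
      neighbour : ∀ x → ∃[ z ] Edge G x z
      vertex    : Fin N

  Diam≤2⇒Dist1⊎Dist2 : Diam≤2 → ∀ {x y} → x ≢ y → Dist G x y 1 ⊎ Dist G x y 2
  Diam≤2⇒Dist1⊎Dist2 d {x} {y} x≢y with Edge? x y | Diam≤2.near d x≢y
  ... | yes x~y | _       = inj₁ (Edge⇒Dist1 x~y)
  ... | no x≁y  | inj₁ x~y = contradiction x~y x≁y
  ... | no x≁y  | inj₂ cn = inj₂ (CommonNeighbour⇒Dist2 x≢y x≁y cn)

  Diam≤2⇒IsL21-injective : Diam≤2 → ∀ {f} → IsL21 G f → Injective _≡_ _≡_ f
  Diam≤2⇒IsL21-injective d {f} L {v} {w} fv≡fw with v ≟ w
  ... | yes v≡w = v≡w
  ... | no v≢w  = contradiction fv≡fw (1≤∣m-n∣⇒m≢n (apart (Diam≤2⇒Dist1⊎Dist2 d v≢w)))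
    where
    apart : Dist G v w 1 ⊎ Dist G v w 2 → 1 ≤ ∣ f v - f w ∣
    apart (inj₁ d₁) = ≤-trans (n≤1+n 1) (proj₁ (L v w) d₁)
    apart (inj₂ d₂) = proj₂ (L v w) d₂

injective⇒large : ∀ {B} (f : Fin (suc B) → ℕ) → Injective _≡_ _≡_ f → ∃[ v ] (B ≤ f v)
injective⇒large {B} f injective with any? (λ v → B ≤? f v)
... | yes large = large
... | no ¬large =
  let f<B v           = ≰⇒> (λ B≤fv → ¬large (v , B≤fv))
      i , j , i<j , eq = pigeonhole ≤-refl (λ v → fromℕ< (f<B v))
  in contradiction (injective (fromℕ<-injective (f i) (f j) (f<B i) (f<B j) eq)) (<ᶠ⇒≢ i<j)

Diam≤2⇒IsL21-large : ∀ {B} {G : Graph (suc B)} → Diam≤2 G → ∀ f → IsL21 G f → ∃[ v ] (B ≤ f v)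
Diam≤2⇒IsL21-large {G = G} d f L = injective⇒large f (Diam≤2⇒IsL21-injective G d L)

IsL21-below⇒¬IsLambda : ∀ {N B} {G : Graph N} {g} → IsL21 G g → (∀ v → g v < B) → ¬ IsLambda G B
IsL21-below⇒¬IsLambda {g = g} L g<B (_ , large) = let v , B≤gv = large g L in <⇒≱ (g<B v) B≤gv

embed : ∀ {n} → MV n → Fin (suc (n + n))
embed {n} (old i)  = suc (i ↑ˡ n)
embed {n} (copy i) = suc (n ↑ʳ i)
embed     hub      = zero

classify-embed : ∀ {n} (p : MV n) → classify {n} (embed p) ≡ p
classify-embed {n} (old i)  rewrite splitAt-↑ˡ n i n = refl
classify-embed {n} (copy i) rewrite splitAt-↑ʳ n n i = refl
classify-embed     hub      = refl

embed-classify : ∀ {n} (v : Fin (suc (n + n))) → embed (classify {n} v) ≡ v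
embed-classify zero = refl
embed-classify {n} (suc k) with splitAt n k | join-splitAt n n k
... | inj₁ i | join≡k = cong suc join≡k
... | inj₂ i | join≡k = cong suc join≡k

classify-injective : ∀ {n} → Injective _≡_ _≡_ (classify {n})
classify-injective {n} {v} {w} eq = trans (sym (embed-classify {n} v)) (trans (cong embed eq) (embed-classify {n} w))

module _ {n : ℕ} (G : Graph n) where

  M-edge⁻ : ∀ p q → Edge (M G) (embed p) (embed q) → madj G p q ≡ true
  M-edge⁻ p q = subst₂ (λ a b → madj G a b ≡ true) (classify-embed p) (classify-embed q)

  Far-M : ∀ {a b} → Far G a b → Far (M G) (embed (old a)) (embed (old b))
  Far-M {a} {b} (mkFar a≢b a≁b ¬cn) = mkFar distinct (a≁b ∘ M-edge⁻ (old a) (old b)) ¬cn-M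
    where
    distinct : embed (old a) ≢ embed (old b)
    distinct eq with trans (sym (classify-embed (old a))) (trans (cong classify eq) (classify-embed (old b)))
    ... | refl = a≢b refl

    through : ∀ p → madj G (old a) p ≡ true → madj G p (old b) ≡ true → ⊥
    through (old c)  a~c c~b = ¬cn (c , a~c , c~b)
    through (copy c) a~c b~c = ¬cn (c , a~c , Edge-sym G b~c)
    through hub      ()  _

    ¬cn-M : ¬ CommonNeighbour (M G) (embed (old a)) (embed (old b))
    ¬cn-M (z , a~z , z~b) =
      through (classify z) (subst (λ p → madj G p (classify z) ≡ true) (classify-embed (old a)) a~z)
                           (subst (λ p → madj G (classify z) p ≡ true) (classify-embed (old b)) z~b)

  MNear : MV n → MV n → Set
  MNear p q = madj G p q ≡ true ⊎ ∃[ r ] (madj G p r ≡ true × madj G r q ≡ true)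

  MNear-sym : ∀ {p q} → MNear q p → MNear p q
  MNear-sym {p} {q} (inj₁ q~p) = inj₁ (trans (madj-sym G p q) q~p)
  MNear-sym {p} {q} (inj₂ (r , q~r , r~p)) = inj₂ (r , trans (madj-sym G p r) r~p , trans (madj-sym G r q) q~r)

  module _ (d : Diam≤2 G) where
    open Diam≤2 d

    MNear-≢ : ∀ {p q} → p ≢ q → MNear p q
    MNear-≢ {old i} {old j} p≢q with near (p≢q ∘ cong old)
    ... | inj₁ i~j              = inj₁ i~j
    ... | inj₂ (z , i~z , z~j)  = inj₂ (old z , i~z , z~j)
    MNear-≢ {old i} {copy j} _ with i ≟ j
    ... | yes refl = let z , i~z = neighbour i in inj₂ (old z , i~z , Edge-sym G i~z)
    ... | no i≢j with near i≢j
    ...   | inj₁ i~j             = inj₁ i~j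
    ...   | inj₂ (z , i~z , z~j) = inj₂ (old z , i~z , z~j)
    MNear-≢ {old i} {hub} _ = let z , i~z = neighbour i in inj₂ (copy z , i~z , refl)
    MNear-≢ {copy i} {old j} p≢q = MNear-sym (MNear-≢ (p≢q ∘ sym))
    MNear-≢ {copy i} {copy j} _ = inj₂ (hub , refl , refl)
    MNear-≢ {copy i} {hub}    _ = inj₁ refl
    MNear-≢ {hub}    {old j} p≢q = MNear-sym (MNear-≢ (p≢q ∘ sym))
    MNear-≢ {hub}    {copy j} _ = inj₁ refl
    MNear-≢ {hub}    {hub}  p≢q = contradiction refl p≢q

    MNeighbour : ∀ p → ∃[ r ] (madj G p r ≡ true)
    MNeighbour (old i)  = let z , i~z = neighbour i in old z , i~z
    MNeighbour (copy i) = hub , refl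
    MNeighbour hub      = copy vertex , refl

    Diam≤2-M : Diam≤2 (M G)
    Diam≤2-M = record { near = near-M ; neighbour = neighbour-M ; vertex = zero }
      where
      adj-embedʳ : ∀ p r → madj G p r ≡ true → madj G p (classify (embed r)) ≡ true
      adj-embedʳ p r = subst (λ s → madj G p s ≡ true) (sym (classify-embed r))

      adj-embedˡ : ∀ q r → madj G r q ≡ true → madj G (classify (embed r)) q ≡ true
      adj-embedˡ q r = subst (λ s → madj G s q ≡ true) (sym (classify-embed r))

      near-M : ∀ {x y} → x ≢ y → Edge (M G) x y ⊎ CommonNeighbour (M G) x y
      near-M {x} {y} x≢y with MNear-≢ (x≢y ∘ classify-injective)
      ... | inj₁ x~y              = inj₁ x~y
      ... | inj₂ (r , x~r , r~y)  = inj₂ (embed r , adj-embedʳ (classify x) r x~r , adj-embedˡ (classify y) r r~y)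

      neighbour-M : ∀ x → ∃[ z ] Edge (M G) x z
      neighbour-M x = let r , x~r = MNeighbour (classify x) in embed r , adj-embedʳ (classify x) r x~r

oldᵗ : ∀ {n} t → Fin n → Fin (morder t n)
oldᵗ zero    x = x
oldᵗ (suc t) x = embed (old (oldᵗ t x))

Far-Mt : ∀ {n} (G : Graph n) t {x y} → Far G x y → Far (Mt t G) (oldᵗ t x) (oldᵗ t y)
Far-Mt G zero    far = far
Far-Mt G (suc t) far = Far-M (Mt t G) (Far-Mt G t far)

Diam≤2-Mt : ∀ {n} (G : Graph n) t → Diam≤2 G → Diam≤2 (Mt t G)
Diam≤2-Mt G zero    d = d
Diam≤2-Mt G (suc t) d = Diam≤2-M (Mt t G) (Diam≤2-Mt G t d)

-- Labelling of M(M(K)) for K on m vertices: low i r gets 3i + r and high a gets 3(m + 1) + a.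
-- Write p′ for the inner and p″ for the outer Mycielski copy, u and w for the inner and outer
-- hub. Row 0 of the grid is w, u, u″; row a + 1 is v_a″, v_a, (v_a′)″; high a is v_a′.
data Slot (m : ℕ) : Set where
  low  : Fin (suc m) → Fin 3 → Slot m
  high : Fin m → Slot m

label : ∀ {m} → Slot m → ℕ
label     (low i r) = toℕ r + toℕ i * 3
label {m} (high a)  = suc m * 3 + toℕ a

label-low≡toℕ-combine : ∀ {m} (i : Fin (suc m)) (r : Fin 3) → label (low i r) ≡ toℕ (combine i r)
label-low≡toℕ-combine i r = begin
  toℕ r + toℕ i * 3  ≡⟨ +-comm (toℕ r) _ ⟩
  toℕ i * 3 + toℕ r  ≡⟨ cong (_+ toℕ r) (*-comm (toℕ i) 3) ⟩
  3 * toℕ i + toℕ r  ≡⟨ toℕ-combine i r ⟨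
  toℕ (combine i r)  ∎
  where open ≡-Reasoning

label-low< : ∀ {m} (i : Fin (suc m)) (r : Fin 3) → label (low i r) < suc m * 3
label-low< i r = subst (_< _) (sym (label-low≡toℕ-combine i r)) (toℕ<n (combine i r))

label-< : ∀ {m} (s : Slot m) → label s < suc m * 3 + m
label-< {m} (low i r) = <-≤-trans (label-low< i r) (m≤m+n _ m)
label-< {m} (high a)  = +-monoʳ-< (suc m * 3) (toℕ<n a)

label-injective : ∀ {m} → Injective _≡_ _≡_ (label {m})
label-injective {x = low i r} {low j s} eq
  with combine-injective i r j s
         (toℕ-injective (trans (sym (label-low≡toℕ-combine i r)) (trans eq (label-low≡toℕ-combine j s))))
... | refl , refl = refl
label-injective {m} {high a} {high b} eq = cong high (toℕ-injective (+-cancelˡ-≡ (suc m * 3) _ _ eq))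
label-injective {m} {low i r} {high b} eq = contradiction eq (<⇒≢ (<-≤-trans (label-low< i r) (m≤m+n _ _)))
label-injective {m} {high a} {low j s} eq = contradiction eq (>⇒≢ (<-≤-trans (label-low< j s) (m≤m+n _ _)))

row-<-gap : ∀ {i j r s} → i < j → r ≤ suc s → 2 + (r + i * 3) ≤ s + j * 3
row-<-gap {i} {j} {r} {s} i<j r≤1+s = begin
  2 + (r + i * 3)    ≤⟨ +-monoʳ-≤ 2 (+-monoˡ-≤ (i * 3) r≤1+s) ⟩
  3 + (s + i * 3)    ≡⟨ carry s i ⟩
  s + suc i * 3      ≤⟨ +-monoʳ-≤ s (*-monoˡ-≤ 3 i<j) ⟩
  s + j * 3          ∎
  where
  open ≤-Reasoning
  carry : ∀ s i → 3 + (s + i * 3) ≡ s + suc i * 3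
  carry = solve-∀

row-separated : ∀ {i j r s} → i ≢ j → r ≤ suc s → s ≤ suc r → Separated (r + i * 3) (s + j * 3)
row-separated {i} {j} i≢j r≤1+s s≤1+r with <-cmp i j
... | tri< i<j _ _ = inj₁ (row-<-gap i<j r≤1+s)
... | tri≈ _ i≡j _ = contradiction i≡j i≢j
... | tri> _ _ j<i = inj₂ (row-<-gap j<i s≤1+r)

vertex-rows-separated : ∀ {m} {a b : Fin m} {r s : Fin 3} →
                        a ≢ b → toℕ r ≤ suc (toℕ s) → toℕ s ≤ suc (toℕ r) →
                        Separated (label (low (suc a) r)) (label (low (suc b) s))
vertex-rows-separated a≢b = row-separated (a≢b ∘ toℕ-injective ∘ suc-injective)

low-high-separated : ∀ {m ℓ} (a : Fin m) → ℓ ≤ suc (m * 3) → Separated ℓ (label (high a))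
low-high-separated {m} a ℓ≤ = inj₁ (≤-trans (s≤s (s≤s ℓ≤)) (m≤m+n (suc m * 3) (toℕ a)))

vertex-row≤ : ∀ {m} (a : Fin m) {r : Fin 3} → toℕ r ≤ 1 → label (low (suc a) r) ≤ suc (m * 3)
vertex-row≤ a r≤1 = +-mono-≤ r≤1 (*-monoˡ-≤ 3 (toℕ<n a))

2≤suc[m*3] : ∀ {m} → Fin m → 2 ≤ suc (m * 3)
2≤suc[m*3] {suc _} _ = s≤s (s≤s z≤n)

module _ {m : ℕ} where

  slotOld : MV m → Slot m
  slotOld (old a)  = low (suc a) (suc zero)
  slotOld (copy a) = high a
  slotOld hub      = low zero (suc zero)

  slotCopy : MV m → Slot m
  slotCopy (old a)  = low (suc a) zero
  slotCopy (copy a) = low (suc a) (suc (suc zero))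
  slotCopy hub      = low zero (suc (suc zero))

  slot : MV (suc (m + m)) → Slot m
  slot (old k)  = slotOld (classify k)
  slot (copy k) = slotCopy (classify k)
  slot hub      = low zero zero

  unslot : Slot m → MV (suc (m + m))
  unslot (low zero    zero)             = hub
  unslot (low zero    (suc zero))       = old (embed {m} hub)
  unslot (low zero    (suc (suc zero))) = copy (embed {m} hub)
  unslot (low (suc a) zero)             = copy (embed (old a))
  unslot (low (suc a) (suc zero))       = old (embed (old a))
  unslot (low (suc a) (suc (suc zero))) = copy (embed (copy a))
  unslot (high a)                       = old (embed (copy a))

  unslot-slotOld : ∀ (p : MV m) → unslot (slotOld p) ≡ old (embed p)
  unslot-slotOld (old _)  = refl
  unslot-slotOld (copy _) = refl
  unslot-slotOld hub      = refl

  unslot-slotCopy : ∀ (p : MV m) → unslot (slotCopy p) ≡ copy (embed p)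
  unslot-slotCopy (old _)  = refl
  unslot-slotCopy (copy _) = refl
  unslot-slotCopy hub      = refl

  unslot-slot : ∀ (p : MV (suc (m + m))) → unslot (slot p) ≡ p
  unslot-slot (old k)  = trans (unslot-slotOld (classify k)) (cong old (embed-classify k))
  unslot-slot (copy k) = trans (unslot-slotCopy (classify k)) (cong copy (embed-classify k))
  unslot-slot hub      = refl

  slot-injective : Injective _≡_ _≡_ slot
  slot-injective {x = p} {q} eq = trans (sym (unslot-slot p)) (trans (cong unslot eq) (unslot-slot q))

  module _ (K : Graph m) where

    slotOld-separated : ∀ p q → madj K p q ≡ true → Separated (label (slotOld p)) (label (slotOld q))
    slotOld-separated (old a)  (old b)  a~b = vertex-rows-separated (Edge⇒≢ K a~b) (s≤s z≤n) (s≤s z≤n)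
    slotOld-separated (old a)  (copy b) _   = low-high-separated b (vertex-row≤ a ≤-refl)
    slotOld-separated (copy a) (old b)  _   = Separated-sym (low-high-separated a (vertex-row≤ b ≤-refl))
    slotOld-separated (copy a) hub      _   = Separated-sym (low-high-separated a (s≤s z≤n))
    slotOld-separated hub      (copy b) _   = low-high-separated b (s≤s z≤n)
    slotOld-separated (old _)  hub      ()
    slotOld-separated (copy _) (copy _) ()
    slotOld-separated hub      (old _)  ()
    slotOld-separated hub      hub      ()

    slotOld-slotCopy-separated : ∀ p q → madj K p q ≡ true → Separated (label (slotOld p)) (label (slotCopy q))
    slotOld-slotCopy-separated (old a)  (old b)  a~b = vertex-rows-separated (Edge⇒≢ K a~b) (s≤s z≤n) z≤n
    slotOld-slotCopy-separated (old a)  (copy b) a~b = vertex-rows-separated (Edge⇒≢ K a~b) (s≤s z≤n) ≤-refl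
    slotOld-slotCopy-separated (copy a) (old b)  _   = Separated-sym (low-high-separated a (vertex-row≤ b z≤n))
    slotOld-slotCopy-separated (copy a) hub      _   = Separated-sym (low-high-separated a (2≤suc[m*3] a))
    slotOld-slotCopy-separated hub      (copy b) _   =
      inj₁ (row-<-gap {0} {suc (toℕ b)} {1} {2} (s≤s z≤n) (s≤s z≤n))
    slotOld-slotCopy-separated (old _)  hub      ()
    slotOld-slotCopy-separated (copy _) (copy _) ()
    slotOld-slotCopy-separated hub      (old _)  ()
    slotOld-slotCopy-separated hub      hub      ()

    slotCopy-hub-separated : ∀ p → Separated (label (slotCopy p)) (label (slot hub))
    slotCopy-hub-separated (old a)  = inj₂ (row-<-gap {0} {suc (toℕ a)} {0} {0} (s≤s z≤n) z≤n)
    slotCopy-hub-separated (copy a) = inj₂ (row-<-gap {0} {suc (toℕ a)} {0} {2} (s≤s z≤n) z≤n)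
    slotCopy-hub-separated hub      = inj₂ ≤-refl

    slot-separated : ∀ p q → madj (M K) p q ≡ true → Separated (label (slot p)) (label (slot q))
    slot-separated (old k)  (old l)  k~l = slotOld-separated (classify k) (classify l) k~l
    slot-separated (old k)  (copy l) k~l = slotOld-slotCopy-separated (classify k) (classify l) k~l
    slot-separated (copy k) (old l)  l~k = Separated-sym (slotOld-slotCopy-separated (classify l) (classify k) l~k)
    slot-separated (copy k) hub      _   = slotCopy-hub-separated (classify k)
    slot-separated hub      (copy k) _   = Separated-sym (slotCopy-hub-separated (classify k))
    slot-separated (old _)  hub      ()
    slot-separated (copy _) (copy _) ()
    slot-separated hub      (old _)  ()
    slot-separated hub      hub      ()

    labelMM : Fin (suc (suc (m + m) + suc (m + m))) → ℕ
    labelMM v = label (slot (classify {suc (m + m)} v))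

    labelMM-injective : Injective _≡_ _≡_ labelMM
    labelMM-injective = classify-injective ∘ slot-injective ∘ label-injective

    labelMM-separated : EdgeSeparated (M (M K)) labelMM
    labelMM-separated v w = slot-separated (classify v) (classify w)

    labelMM≤ : ∀ v → labelMM v ≤ suc (m + m) + suc (m + m)
    labelMM≤ v = s≤s⁻¹ (subst (labelMM v <_) (order m) (label-< (slot (classify v))))
      where
      order : ∀ m → suc m * 3 + m ≡ suc (suc (m + m) + suc (m + m))
      order = solve-∀

    inner : MV m → Fin (suc (suc (m + m) + suc (m + m)))
    inner p = embed (old (embed p))

    outer-copy : MV m → Fin (suc (suc (m + m) + suc (m + m)))
    outer-copy p = embed (copy (embed p))

    labelMM-inner : ∀ p → labelMM (inner p) ≡ label (slotOld p)
    labelMM-inner p =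
      trans (cong (label ∘ slot) (classify-embed {suc (m + m)} (old (embed p))))
            (cong (label ∘ slotOld) (classify-embed p))

    labelMM-outer-copy : ∀ p → labelMM (outer-copy p) ≡ label (slotCopy p)
    labelMM-outer-copy p =
      trans (cong (label ∘ slot) (classify-embed {suc (m + m)} (copy (embed p))))
            (cong (label ∘ slotCopy) (classify-embed p))

    labelMM-below : ∀ a → suc (labelMM (outer-copy (old a))) ≡ labelMM (inner (old a))
    labelMM-below a = trans (cong suc (labelMM-outer-copy (old a))) (sym (labelMM-inner (old a)))

    labelMM-above : ∀ a → labelMM (outer-copy (copy a)) ≡ suc (labelMM (inner (old a)))
    labelMM-above a = trans (labelMM-outer-copy (copy a)) (sym (cong suc (labelMM-inner (old a))))

    labelMM-inner-separated : ∀ {a b} → a ≢ b → Separated (labelMM (inner (old a))) (labelMM (inner (old b)))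
    labelMM-inner-separated {a} {b} a≢b =
      subst₂ Separated (sym (labelMM-inner (old a))) (sym (labelMM-inner (old b)))
             (vertex-rows-separated a≢b (s≤s z≤n) (s≤s z≤n))

    outer-copy-edge : ∀ p a → Edge (M (M K)) (outer-copy p) (inner (old a)) → madj K (old a) p ≡ true
    outer-copy-edge p a = M-edge⁻ K (old a) p ∘ M-edge⁻ (M K) (copy (embed p)) (old (embed (old a)))

    outer-copies-nonadjacent : ∀ p q → ¬ Edge (M (M K)) (outer-copy p) (outer-copy q)
    outer-copies-nonadjacent p q e with M-edge⁻ (M K) (copy (embed p)) (copy (embed q)) e
    ... | ()

    IsLambda-MM : Diam≤2 K → IsLambda (M (M K)) (suc (m + m) + suc (m + m))
    IsLambda-MM d =
      (labelMM , injective⇒IsL21 (M (M K)) labelMM-separated labelMM-injective , labelMM≤) ,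
      Diam≤2⇒IsL21-large (Diam≤2-M (M K) (Diam≤2-M K d))

-- collapsed gives y the label of x and closes the gap left at f y. The vertices x⁻, x⁺ carrying
-- the labels next to f x are not adjacent to y, which keeps the new label of y away from those of
-- its neighbours; y⁻, y⁺ carry the labels next to f y, and their non-adjacency is exactly what
-- closing the gap needs.
module Collapse {N B : ℕ} (G : Graph N) (f : Fin N → ℕ)
  (f-injective : Injective _≡_ _≡_ f) (f-separated : EdgeSeparated G f) (f≤B : ∀ v → f v ≤ B)
  {x y : Fin N} (far : Far G x y) (fx⋈fy : Separated (f x) (f y))
  {x⁻ x⁺ : Fin N} (x⁻-label : suc (f x⁻) ≡ f x) (x⁺-label : f x⁺ ≡ suc (f x))
  (x⁻≁y : ¬ Edge G x⁻ y) (x⁺≁y : ¬ Edge G x⁺ y)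
  {y⁻ y⁺ : Fin N} (y⁻-label : suc (f y⁻) ≡ f y) (y⁺-label : f y⁺ ≡ suc (f y))
  (y⁻≁y⁺ : ¬ Edge G y⁻ y⁺)
  where

  open Far far renaming (distinct to x≢y; nonadjacent to x≁y; no-common-neighbour to ¬cn)

  redirect : Fin N → Fin N
  redirect v with v ≟ y
  ... | yes _ = x
  ... | no  _ = v

  redirect-view : ∀ v → (v ≡ y × redirect v ≡ x) ⊎ (v ≢ y × redirect v ≡ v)
  redirect-view v with v ≟ y
  ... | yes v≡y = inj₁ (v≡y , refl)
  ... | no  v≢y = inj₂ (v≢y , refl)

  f-redirect≢fy : ∀ v → f (redirect v) ≢ f y
  f-redirect≢fy v with redirect-view v
  ... | inj₁ (_ , r≡x)   = λ eq → x≢y (trans (sym r≡x) (f-injective eq))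
  ... | inj₂ (v≢y , r≡v) = λ eq → v≢y (trans (sym r≡v) (f-injective eq))

  neighbour-of-y : ∀ {w} → Edge G w y → Separated (f w) (f x)
  neighbour-of-y {w} w~y =
    ≢∧≢±1⇒Separated (λ eq → avoid eq x≁y)
                     (λ eq → avoid (suc-injective (trans eq (sym x⁻-label))) x⁻≁y)
                     (λ eq → avoid (trans eq (sym x⁺-label)) x⁺≁y)
    where
    avoid : ∀ {z} → f w ≡ f z → ¬ Edge G z y → ⊥
    avoid eq z≁y = z≁y (subst (λ z → Edge G z y) (f-injective eq) w~y)

  ¬Straddles : ∀ {v w} → Edge G v w → ¬ Straddles (f y) (f v) (f w)
  ¬Straddles v~w (1+fv≡fy , fw≡1+fy) =
    y⁻≁y⁺ (subst₂ (Edge G) (f-injective (suc-injective (trans 1+fv≡fy (sym y⁻-label))))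
                            (f-injective (trans fw≡1+fy (sym y⁺-label))) v~w)

  redirected-edge : ∀ {v w} → Edge G v w →
    Separated (f (redirect v)) (f (redirect w)) × ¬ Straddles (f y) (f (redirect v)) (f (redirect w))
  redirected-edge {v} {w} v~w with redirect-view v | redirect-view w
  ... | inj₁ (refl , _)  | inj₁ (refl , _) = contradiction refl (Edge⇒≢ G v~w)
  ... | inj₁ (refl , rv) | inj₂ (_ , rw) rewrite rv | rw =
    Separated-sym (neighbour-of-y (Edge-sym G v~w)) , λ (1+fx≡fy , _) → Separated⇒suc≢ fx⋈fy 1+fx≡fy
  ... | inj₂ (_ , rv) | inj₁ (refl , rw) rewrite rv | rw =
    neighbour-of-y v~w , λ (_ , fx≡1+fy) → Separated⇒suc≢ (Separated-sym fx⋈fy) (sym fx≡1+fy)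
  ... | inj₂ (_ , rv) | inj₂ (_ , rw) rewrite rv | rw = f-separated _ _ v~w , ¬Straddles v~w

  redirect-near : ∀ {v w} → v ≢ w → CommonNeighbour G v w → redirect v ≢ redirect w
  redirect-near {v} {w} v≢w cn with redirect-view v | redirect-view w
  ... | inj₁ (refl , _)  | inj₁ (refl , _)  = contradiction refl v≢w
  ... | inj₁ (refl , rv) | inj₂ (_ , rw)    rewrite rv | rw =
    λ x≡w → ¬cn (CommonNeighbour-sym G (subst (CommonNeighbour G y) (sym x≡w) cn))
  ... | inj₂ (_ , rv)    | inj₁ (refl , rw) rewrite rv | rw =
    λ v≡x → ¬cn (subst (λ z → CommonNeighbour G z y) v≡x cn)
  ... | inj₂ (_ , rv)    | inj₂ (_ , rw)    rewrite rv | rw = v≢w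

  collapsed : Fin N → ℕ
  collapsed v = shrink (f y) (f (redirect v))

  collapsed-IsL21 : IsL21 G collapsed
  collapsed-IsL21 = IsL21-intro G separated near
    where
    separated : EdgeSeparated G collapsed
    separated v w v~w =
      let sep , ¬vw = redirected-edge v~w in
      shrink-separated (f-redirect≢fy v) (f-redirect≢fy w) sep ¬vw (proj₂ (redirected-edge (Edge-sym G v~w)))

    near : ∀ v w → v ≢ w → CommonNeighbour G v w → collapsed v ≢ collapsed w
    near v w v≢w cn eq =
      redirect-near v≢w cn (f-injective (shrink-injective (f-redirect≢fy v) (f-redirect≢fy w) eq))

  collapsed-< : ∀ v → collapsed v < B
  collapsed-< v = shrink-< (f-redirect≢fy v) (f≤B (redirect v)) (f≤B y)

¬IsLambda-MM : ∀ {m} (K : Graph m) {x y} → Far K x y → ¬ IsLambda (M (M K)) (suc (m + m) + suc (m + m))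
¬IsLambda-MM K {x} {y} far@(mkFar x≢y x≁y _) = IsL21-below⇒¬IsLambda collapsed-IsL21 collapsed-<
  where
  open Collapse (M (M K)) (labelMM K) (labelMM-injective K) (labelMM-separated K) (labelMM≤ K)
    (Far-M (M K) (Far-M K far)) (labelMM-inner-separated K x≢y)
    {x⁻ = outer-copy K (old x)} {x⁺ = outer-copy K (copy x)} (labelMM-below K x) (labelMM-above K x)
    (x≁y ∘ Edge-sym K ∘ outer-copy-edge K (old x) y) (x≁y ∘ Edge-sym K ∘ outer-copy-edge K (copy x) y)
    {y⁻ = outer-copy K (old y)} {y⁺ = outer-copy K (copy y)} (labelMM-below K y) (labelMM-above K y)
    (outer-copies-nonadjacent K (old y) (copy y))

eqb-≢ : ∀ {n} {a b : Fin n} → a ≢ b → eqb a b ≡ false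
eqb-≢ {a = a} {b} a≢b with a ≟ b
... | yes a≡b = contradiction a≡b a≢b
... | no _    = refl

module _ {n : ℕ} (G : Graph n) where

  ¬Far⇒complete⊎diam2 : ¬ (∃[ x ] ∃[ y ] Far G x y) → G ≅ complete n ⊎ Diam G 2
  ¬Far⇒complete⊎diam2 ¬far with any? (λ x → any? (λ y → ¬? (x ≟ y) ×-dec ¬? (Edge? G x y)))
  ... | no ¬nonadjacent = inj₁ (↔-id _ , adjacent)
    where
    adjacent : ∀ a b → adj G a b ≡ bnot (eqb a b)
    adjacent a b with a ≟ b
    ... | yes refl = irrefl G a
    ... | no a≢b   = decidable-stable (Edge? G a b) (λ a≁b → ¬nonadjacent (a , b , a≢b , a≁b))
  ... | yes (x , y , x≢y , x≁y) =
    inj₂ (within2 , x , y , CommonNeighbour⇒Dist2 G x≢y x≁y (common x≢y x≁y))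
    where
    common : ∀ {a b} → a ≢ b → ¬ Edge G a b → CommonNeighbour G a b
    common {a} {b} a≢b a≁b =
      decidable-stable (CommonNeighbour? G a b) (λ ¬cn → ¬far (a , b , mkFar a≢b a≁b ¬cn))

    within2 : ∀ a b → ∃[ e ] (e ≤ 2 × Dist G a b e)
    within2 a b with a ≟ b | Edge? G a b
    ... | yes a≡b | _       = 0 , z≤n , a≡b , λ _ ()
    ... | no _    | yes a~b = 1 , s≤s z≤n , Edge⇒Dist1 G a~b
    ... | no a≢b  | no a≁b  = 2 , ≤-refl , CommonNeighbour⇒Dist2 G a≢b a≁b (common a≢b a≁b)

module _ {n : ℕ} (G : Graph (suc (suc n))) where

  near⇒Diam≤2 : (∀ {x y} → x ≢ y → Edge G x y ⊎ CommonNeighbour G x y) → Diam≤2 G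
  near⇒Diam≤2 near = record { near = near ; neighbour = neighbour ; vertex = zero }
    where
    other : Fin (suc (suc n)) → Fin (suc (suc n))
    other zero    = suc zero
    other (suc _) = zero

    ≢other : ∀ x → x ≢ other x
    ≢other zero    ()
    ≢other (suc _) ()

    neighbour : ∀ x → ∃[ z ] Edge G x z
    neighbour x with near (≢other x)
    ... | inj₁ x~y            = other x , x~y
    ... | inj₂ (z , x~z , _)  = z , x~z

  complete⇒Diam≤2 : G ≅ complete (suc (suc n)) → Diam≤2 G
  complete⇒Diam≤2 (σ , σ-adj) = near⇒Diam≤2 λ {x} {y} x≢y →
    inj₁ (trans (σ-adj x y) (cong bnot (eqb-≢ (x≢y ∘ to-injective))))
    where
    open Inverse σ using (to; from; strictlyInverseʳ)
    to-injective : ∀ {x y} → to x ≡ to y → x ≡ y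
    to-injective {x} {y} eq = trans (sym (strictlyInverseʳ x)) (trans (cong from eq) (strictlyInverseʳ y))

  diam2⇒Diam≤2 : Diam G 2 → Diam≤2 G
  diam2⇒Diam≤2 (within2 , _) = near⇒Diam≤2 near
    where
    near : ∀ {x y} → x ≢ y → Edge G x y ⊎ CommonNeighbour G x y
    near {x} {y} x≢y with within2 x y
    ... | zero , _ , x≡y , _                = contradiction x≡y x≢y
    ... | suc zero , _ , d                  = inj₁ (Dist1⇒Edge G d)
    ... | suc (suc zero) , _ , d            = inj₂ (proj₂ (Dist2⇒CommonNeighbour G d))
    ... | suc (suc (suc _)) , s≤s (s≤s ()) , _

2^t*[n+1]≡suc-morder : ∀ t n → 2 ^ t * (n + 1) ≡ suc (morder t n)
2^t*[n+1]≡suc-morder zero    n = trans (+-identityʳ (n + 1)) (+-comm n 1)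
2^t*[n+1]≡suc-morder (suc t) n = begin
  2 * 2 ^ t * (n + 1)         ≡⟨ *-assoc 2 (2 ^ t) (n + 1) ⟩
  2 * (2 ^ t * (n + 1))       ≡⟨ cong (2 *_) (2^t*[n+1]≡suc-morder t n) ⟩
  2 * suc (morder t n)        ≡⟨ double-suc (morder t n) ⟩
  suc (suc (morder t n + morder t n)) ∎
  where
  open ≡-Reasoning
  double-suc : ∀ k → 2 * suc k ≡ suc (suc (k + k))
  double-suc = solve-∀

theorem4p3 : (n : ℕ) (G : Graph n) (t : ℕ) → 2 ≤ n → 2 ≤ t →
    (IsLambda (Mt t G) (2 ^ t * (n + 1) ∸ 2) ⇔ (G ≅ complete n ⊎ Diam G 2))
theorem4p3 n@(suc (suc _)) G t@(suc (suc t-2)) (s≤s (s≤s z≤n)) (s≤s (s≤s z≤n)) =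
  -- suc (morder t n) ∸ 2 reduces to the bound in IsLambda-MM and ¬IsLambda-MM.
  subst (λ B → IsLambda (Mt t G) B ⇔ (G ≅ complete n ⊎ Diam G 2))
        (sym (cong (_∸ 2) (2^t*[n+1]≡suc-morder t n)))
        (mk⇔ to from)
  where
  K = Mt t-2 G

  to : IsLambda (M (M K)) _ → G ≅ complete n ⊎ Diam G 2
  to λ-MMK with any? (λ x → any? (λ y → Far? G x y))
  ... | yes (_ , _ , far) = contradiction λ-MMK (¬IsLambda-MM K (Far-Mt G t-2 far))
  ... | no ¬far           = ¬Far⇒complete⊎diam2 G ¬far

  from : G ≅ complete n ⊎ Diam G 2 → IsLambda (M (M K)) _
  from = IsLambda-MM K ∘ Diam≤2-Mt G t-2 ∘ [ complete⇒Diam≤2 G , diam2⇒Diam≤2 G ]′
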